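{- Let $\mathcal{A}$, $\delta$ and $\mathcal{C}$ be as in the context. For every $a\in\mathcal{A}$: if $a\in\mathcal{C}$ then $\delta a=a$; otherwise $a<\delta a$ in the lexicographic order.
   Context: $\mathcal{A}$ is the set of finite integer sequences $a=(a_0,\dots,a_n)$ ($n\ge0$) with $0\le a_i\le i$ for all $i$; $\mathcal{A}_n$ is the set of those of length $n+1$. Define $\delta:\mathcal{A}\to\mathcal{A}$ by $(\delta a)_i=\#\{j : j<i,\ a_j<a_i\}$. Lexicographic order on sequences of equal length: $a<b$ if $a_i<b_i$ at the first index where they differ. The Catalan family $\mathcal{C}=\bigcup_n\mathcal{C}_n$, $\mathcal{C}_n\subseteq\mathcal{A}_n$: $\mathcal{C}_0=\{(0)\}$; for $a=(a_0,\dots,a_n)\in\mathcal{C}_n$ let $S(a)=\{x : (a_0,\dots,a_{n-1},x)\in\mathcal{C}_n\}$ (with $S((0))=\{0\}$); then $\mathcal{C}_{n+1}$ consists of all $(a_0,\dots,a_n,y)$ with $a\in\mathcal{C}_n$ and $y\in\{s\in S(a): s\le a_n\}\cup\{n+1\}$. -}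

module Defs where

open import Data.Nat using (ℕ; zero; suc; _≤_; _<_; _<?_)
open import Data.List using (List; []; _∷_; [_]; _∷ʳ_; length; filter; lookup)
open import Data.Fin using (Fin; toℕ)
open import Relation.Binary.PropositionalEquality using (_≡_; _≢_)
open import Data.Product using (_×_)

InA : List ℕ → Set
InA a = (a ≢ []) × ((i : Fin (length a)) → lookup a i ≤ toℕ i)

-- δ: (δ a)_i = #{ j < i : a_j < a_i }.
-- δ-go pre xs : pre is the list of earlier entries.
δ-go : List ℕ → List ℕ → List ℕ
δ-go pre []       = []
δ-go pre (x ∷ xs) = length (filter (_<? x) pre) ∷ δ-go (pre ∷ʳ x) xs

δ : List ℕ → List ℕ
δ a = δ-go [] a

data LexLt : List ℕ → List ℕ → Set where
  here  : ∀ {x y xs ys} → x < y → length xs ≡ length ys → LexLt (x ∷ xs) (y ∷ ys)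
  there : ∀ {x xs ys} → LexLt xs ys → LexLt (x ∷ xs) (x ∷ ys)

-- The Catalan family 𝒞.
--  * (0) ∈ 𝒞_0
--  * a ∈ 𝒞_n (a of length n+1)  ⇒  a ++ (n+1) ∈ 𝒞_{n+1}
--  * a = pre ++ (a_n) ∈ 𝒞_n, s ∈ S(a) (i.e. pre ++ (s) ∈ 𝒞_n), s ≤ a_n
--      ⇒  pre ++ (a_n, s) ∈ 𝒞_{n+1}
data InC : List ℕ → Set where
  base : InC [ 0 ]
  new  : ∀ {a} → InC a → InC (a ∷ʳ length a)
  old  : ∀ {pre x s} → InC (pre ∷ʳ x) → InC (pre ∷ʳ s) → s ≤ x →
         InC (pre ∷ʳ x ∷ʳ s)

{-# OPTIONS --safe #-}
-- For a ∈ 𝒜 and an index i with a_i = x, the entries a_0, …, a_{x-1} are all below x, so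
-- (δa)_i ≥ a_i. Hence δa ≥ a entrywise, and δa ≠ a already gives a < δa at the first difference.
-- It remains to see that the fixed points of δ are exactly 𝒞. Elements of 𝒞 are fixed, because
-- appending s ≤ a_n to a_0 … a_n does not change the number of earlier entries below s.
-- Conversely, if p ∈ 𝒞, x ≤ |p| and exactly x entries of p lie below x, then p·x ∈ 𝒞: either
-- x = |p|, or p = q·s with x ≤ s, since s < x would leave only x − 1 entries of q below x
-- although x ≤ |q|; then q·x ∈ 𝒞 by induction, and p·x = q·s·x is obtained from q·s and q·x.
module Submission where

open import Defs
open import Data.Nat using (ℕ; suc; _+_; _≤_; _<_; _<?_; z≤n; s≤s; z<s)
open import Data.Nat.Properties
open import Data.List using (List; []; _∷_; [_]; _∷ʳ_; _++_; length; filter; lookup)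
open import Data.List.Properties
  using ( length-++; length-++-≤ˡ; ∷ʳ-injectiveʳ; ∷ʳ-++; ++-identityʳ
        ; filter-++; filter-accept; filter-reject; filter-all)
open import Data.List.Relation.Unary.All using (All; []; _∷_)
open import Data.Fin using (Fin; toℕ) renaming (zero to fzero; suc to fsuc)
open import Data.Product using (_×_; _,_)
open import Data.Sum using (_⊎_; inj₁; inj₂; [_,_]′) renaming (map to ⊎-map)
open import Data.Empty using (⊥-elim)
open import Function using (_∘_)
open import Relation.Nullary using (¬_; yes; no)
open import Relation.Binary.PropositionalEquality
  using (_≡_; refl; sym; trans; cong; cong₂; subst; module ≡-Reasoning)

countBelow : List ℕ → ℕ → ℕ
countBelow l x = length (filter (_<? x) l)

length-∷ʳ : ∀ (l : List ℕ) y → length (l ∷ʳ y) ≡ suc (length l)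
length-∷ʳ l y = trans (length-++ l) (+-comm (length l) 1)

<length-∷ʳ⇒≤length : ∀ l {y x} → x < length (l ∷ʳ y) → x ≤ length l
<length-∷ʳ⇒≤length l {y} {x} x<n = ≤-pred (subst (x <_) (length-∷ʳ l y) x<n)

countBelow-∷ʳ : ∀ l y x → countBelow (l ∷ʳ y) x ≡ countBelow l x + countBelow [ y ] x
countBelow-∷ʳ l y x = trans (cong length (filter-++ (_<? x) l [ y ])) (length-++ (filter (_<? x) l))

countBelow-∷ʳ-< : ∀ l {y x} → y < x → countBelow (l ∷ʳ y) x ≡ suc (countBelow l x)
countBelow-∷ʳ-< l {y} {x} y<x = begin
  countBelow (l ∷ʳ y) x            ≡⟨ countBelow-∷ʳ l y x ⟩
  countBelow l x + countBelow [ y ] x ≡⟨ cong ((countBelow l x +_) ∘ length) (filter-accept (_<? x) y<x) ⟩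
  countBelow l x + 1               ≡⟨ +-comm (countBelow l x) 1 ⟩
  suc (countBelow l x)             ∎
  where open ≡-Reasoning

countBelow-∷ʳ-≥ : ∀ l {y x} → x ≤ y → countBelow (l ∷ʳ y) x ≡ countBelow l x
countBelow-∷ʳ-≥ l {y} {x} x≤y = begin
  countBelow (l ∷ʳ y) x            ≡⟨ countBelow-∷ʳ l y x ⟩
  countBelow l x + countBelow [ y ] x ≡⟨ cong ((countBelow l x +_) ∘ length) (filter-reject (_<? x) (≤⇒≯ x≤y)) ⟩
  countBelow l x + 0               ≡⟨ +-identityʳ (countBelow l x) ⟩
  countBelow l x                   ∎
  where open ≡-Reasoning

-- The entry of xs at index i is at most k + i: xs is a tail, starting at index k, of an element of 𝒜.
data AdmissibleFrom (k : ℕ) : List ℕ → Set where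
  []  : AdmissibleFrom k []
  _∷_ : ∀ {x xs} → x ≤ k → AdmissibleFrom (suc k) xs → AdmissibleFrom k (x ∷ xs)

lookup≤⇒AdmissibleFrom : ∀ k (a : List ℕ) → ((i : Fin (length a)) → lookup a i ≤ k + toℕ i) →
                         AdmissibleFrom k a
lookup≤⇒AdmissibleFrom k []       bounds = []
lookup≤⇒AdmissibleFrom k (x ∷ xs) bounds =
  subst (x ≤_) (+-identityʳ k) (bounds fzero) ∷
  lookup≤⇒AdmissibleFrom (suc k) xs (λ i → subst (lookup xs i ≤_) (+-suc k (toℕ i)) (bounds (fsuc i)))

AdmissibleFrom-∷ʳ⁺ : ∀ {k l y} → AdmissibleFrom k l → y ≤ k + length l → AdmissibleFrom k (l ∷ʳ y)
AdmissibleFrom-∷ʳ⁺ {k} {y = y} []          y≤k   = subst (y ≤_) (+-identityʳ k) y≤k ∷ []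
AdmissibleFrom-∷ʳ⁺ {k} {y = y} (x≤k ∷ adm) y≤k+n =
  x≤k ∷ AdmissibleFrom-∷ʳ⁺ adm (subst (y ≤_) (+-suc k _) y≤k+n)

AdmissibleFrom-last : ∀ {k} l {y} → AdmissibleFrom k (l ∷ʳ y) → y ≤ k + length l
AdmissibleFrom-last {k} []      {y} (y≤k ∷ [])  = subst (y ≤_) (sym (+-identityʳ k)) y≤k
AdmissibleFrom-last {k} (_ ∷ l) {y} (_ ∷ adm)   =
  subst (y ≤_) (sym (+-suc k (length l))) (AdmissibleFrom-last l adm)

AdmissibleFrom⇒All< : ∀ {k l x} → AdmissibleFrom k l → k + length l ≤ x → All (_< x) l
AdmissibleFrom⇒All< []                      _   = []
AdmissibleFrom⇒All< {k} {_ ∷ l} {x} (y≤k ∷ adm) k+n≤x =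
  ≤-<-trans y≤k (<-≤-trans (m<m+n k z<s) k+n≤x) ∷
  AdmissibleFrom⇒All< adm (subst (_≤ x) (+-suc k (length l)) k+n≤x)

countBelow-admissible-all : ∀ {k l} → AdmissibleFrom k l → countBelow l (k + length l) ≡ length l
countBelow-admissible-all adm = cong length (filter-all (_<? _) (AdmissibleFrom⇒All< adm ≤-refl))

≤countBelow : ∀ {k l x} → AdmissibleFrom k l → x ≤ k + length l → x ≤ k + countBelow l x
≤countBelow                  []          x≤k   = x≤k
≤countBelow {k} {y ∷ l} {x} (y≤k ∷ adm) x≤k+n with y <? x
... | no  y≮x = ≤-trans (≤-trans (≮⇒≥ y≮x) y≤k) (m≤m+n k _)
... | yes y<x = begin
  x                        ≤⟨ ≤countBelow adm (subst (x ≤_) (+-suc k (length l)) x≤k+n) ⟩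
  suc k + countBelow l x   ≡⟨ sym (+-suc k (countBelow l x)) ⟩
  k + suc (countBelow l x) ≡⟨ sym (cong ((k +_) ∘ length) (filter-accept (_<? x) y<x)) ⟩
  k + countBelow (y ∷ l) x ∎
  where open ≤-Reasoning

δ-go-∷ʳ : ∀ pre xs y → δ-go pre (xs ∷ʳ y) ≡ δ-go pre xs ∷ʳ countBelow (pre ++ xs) y
δ-go-∷ʳ pre []       y = cong (λ l → countBelow l y ∷ []) (sym (++-identityʳ pre))
δ-go-∷ʳ pre (x ∷ xs) y = cong (countBelow pre x ∷_) (begin
  δ-go (pre ∷ʳ x) (xs ∷ʳ y)                            ≡⟨ δ-go-∷ʳ (pre ∷ʳ x) xs y ⟩
  δ-go (pre ∷ʳ x) xs ∷ʳ countBelow (pre ∷ʳ x ++ xs) y  ≡⟨ cong (λ l → δ-go (pre ∷ʳ x) xs ∷ʳ countBelow l y)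
                                                              (∷ʳ-++ pre x xs) ⟩
  δ-go (pre ∷ʳ x) xs ∷ʳ countBelow (pre ++ x ∷ xs) y   ∎)
  where open ≡-Reasoning

δ-∷ʳ : ∀ l y → δ (l ∷ʳ y) ≡ δ l ∷ʳ countBelow l y
δ-∷ʳ = δ-go-∷ʳ []

length-δ-go : ∀ pre xs → length (δ-go pre xs) ≡ length xs
length-δ-go pre []       = refl
length-δ-go pre (x ∷ xs) = cong suc (length-δ-go (pre ∷ʳ x) xs)

InC⇒AdmissibleFrom0 : ∀ {a} → InC a → AdmissibleFrom 0 a
InC⇒AdmissibleFrom0 base                    = z≤n ∷ []
InC⇒AdmissibleFrom0 (new c)                 = AdmissibleFrom-∷ʳ⁺ (InC⇒AdmissibleFrom0 c) ≤-refl
InC⇒AdmissibleFrom0 (old {pre} {x} cx cs _) =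
  AdmissibleFrom-∷ʳ⁺ (InC⇒AdmissibleFrom0 cx)
    (≤-trans (AdmissibleFrom-last pre (InC⇒AdmissibleFrom0 cs)) (length-++-≤ˡ pre))

InC⇒δ-fixed : ∀ {a} → InC a → δ a ≡ a
InC⇒δ-fixed base                       = refl
InC⇒δ-fixed (new {a} c)                =
  trans (δ-∷ʳ a (length a))
        (cong₂ _∷ʳ_ (InC⇒δ-fixed c) (countBelow-admissible-all (InC⇒AdmissibleFrom0 c)))
InC⇒δ-fixed (old {pre} {x} {s} cx cs s≤x) =
  trans (δ-∷ʳ (pre ∷ʳ x) s)
        (cong₂ _∷ʳ_ (InC⇒δ-fixed cx) (trans (countBelow-∷ʳ-≥ pre s≤x) countBelow-pre-s))
  where
    countBelow-pre-s : countBelow pre s ≡ s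
    countBelow-pre-s = ∷ʳ-injectiveʳ (δ pre) pre (trans (sym (δ-∷ʳ pre s)) (InC⇒δ-fixed cs))

mutual
  InC-∷ʳ : ∀ {p x} → InC p → x ≤ length p → countBelow p x ≡ x → InC (p ∷ʳ x)
  InC-∷ʳ c x≤n eq with m≤n⇒m<n∨m≡n x≤n
  ... | inj₁ x<n  = InC-∷ʳ-< c x<n eq
  ... | inj₂ refl = new c

  InC-∷ʳ-< : ∀ {p x} → InC p → x < length p → countBelow p x ≡ x → InC (p ∷ʳ x)
  InC-∷ʳ-< base (s≤s z≤n) _ = old {pre = []} base base z≤n
  InC-∷ʳ-< {x = x} (new {a} c) x<n eq =
    old (new c) (InC-∷ʳ c x≤a (trans (sym (countBelow-∷ʳ-≥ a x≤a)) eq)) x≤a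
    where
      x≤a : x ≤ length a
      x≤a = <length-∷ʳ⇒≤length a x<n
  InC-∷ʳ-< {x = x} (old {pre} {y} {s} cy cs s≤y) x<n eq with s <? x
  ... | yes s<x = ⊥-elim (1+n≰n (subst (_≤ countBelow (pre ∷ʳ y) x) (sym suc-count≡x) x≤count))
    where
      x≤count : x ≤ countBelow (pre ∷ʳ y) x
      x≤count = ≤countBelow (InC⇒AdmissibleFrom0 cy) (<length-∷ʳ⇒≤length (pre ∷ʳ y) x<n)
      suc-count≡x : suc (countBelow (pre ∷ʳ y) x) ≡ x
      suc-count≡x = trans (sym (countBelow-∷ʳ-< (pre ∷ʳ y) s<x)) eq
  ... | no  s≮x = old (old cy cs s≤y) (InC-∷ʳ cy (<length-∷ʳ⇒≤length (pre ∷ʳ y) x<n) eq′) x≤s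
    where
      x≤s : x ≤ s
      x≤s = ≮⇒≥ s≮x
      eq′ : countBelow (pre ∷ʳ y) x ≡ x
      eq′ = trans (sym (countBelow-∷ʳ-≥ (pre ∷ʳ y) x≤s)) eq

δ-go-progress : ∀ {pre} xs → InC pre → AdmissibleFrom (length pre) xs →
                InC (pre ++ xs) ⊎ LexLt xs (δ-go pre xs)
δ-go-progress {pre} []       c []          = inj₁ (subst InC (sym (++-identityʳ pre)) c)
δ-go-progress {pre} (x ∷ xs) c (x≤n ∷ adm)
  with m≤n⇒m<n∨m≡n (≤countBelow (InC⇒AdmissibleFrom0 c) x≤n)
... | inj₁ x<count = inj₂ (here x<count (sym (length-δ-go (pre ∷ʳ x) xs)))
... | inj₂ x≡count =
  ⊎-map (subst InC (∷ʳ-++ pre x xs))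
        (subst (λ z → LexLt (x ∷ xs) (z ∷ δ-go (pre ∷ʳ x) xs)) x≡count ∘ there)
        (δ-go-progress xs (InC-∷ʳ c x≤n (sym x≡count))
                          (subst (λ n → AdmissibleFrom n xs) (sym (length-∷ʳ pre x)) adm))

lemma3 : (a : List ℕ) → InA a →
         (InC a → δ a ≡ a) × (¬ InC a → LexLt a (δ a))
lemma3 []       (nonempty , _) = ⊥-elim (nonempty refl)
lemma3 (x ∷ xs) (_ , bounds) with lookup≤⇒AdmissibleFrom 0 (x ∷ xs) bounds
... | z≤n ∷ adm = InC⇒δ-fixed , λ ∉C → [ ⊥-elim ∘ ∉C , there ]′ (δ-go-progress xs base adm)
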